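{- For every positive integer $r$ there is an integer $N^* = N^*(r)$ such that for all $n \ge N^*$, the vertex set of any multigraph $G$ of order $2n$ with multiplicity at most $r$ can be partitioned into two parts $A$ and $B$ with $|A| = |B| = n$ such that every vertex $v$ of $G$ satisfies $|d_A(v) - d_B(v)| < n^{2/3}$.
   Context: All graphs are multigraphs: multiple edges allowed, no loops. The multiplicity is the maximum number of edges joining the same pair of vertices. For a set of vertices $S$ and a vertex $v$, $d_S(v)$ denotes the number of edges joining $v$ to a vertex of $S$ (counted with multiplicity). -}

module Defs where

open import Data.Nat using (ℕ; _≤_; _+_)
open import Data.Fin using (Fin; _≟_)
open import Data.Fin.Subset using (Subset)
open import Data.List using (map; allFin)
open import Data.Nat.ListAction using (sum)
open import Data.Vec using (lookup)
open import Data.Bool using (if_then_else_)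
open import Relation.Binary.PropositionalEquality using (_≡_)

record Multigraph (k : ℕ) : Set where
  field
    mult      : Fin k → Fin k → ℕ
    symmetric : ∀ u v → mult u v ≡ mult v u
    loopless  : ∀ v → mult v v ≡ 0
open Multigraph public

MultiplicityAtMost : {k : ℕ} → ℕ → Multigraph k → Set
MultiplicityAtMost r G = ∀ u v → mult G u v ≤ r

deg : {k : ℕ} → Multigraph k → Subset k → Fin k → ℕ
deg {k} G S v = sum (map (λ u → if lookup S u then mult G v u else 0) (allFin k))

-- Pair vertex i with vertex n + i and, for each pair, decide which of the two
-- goes to A.  The discrepancy d_A(v) - d_B(v) of a vertex v then changes, pair by
-- pair, by ±(m(v,i) - m(v,n+i)), a step of size at most r.  We choose the signs
-- greedily (method of conditional expectations) so that the potential
--     Φ_M = Σ_v (D_v² + M)⁴,   D_v the current discrepancy of v,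
-- never exceeds its value at the start with a slack M = (pairs left) · 7r².
-- The key inequality is that the two possible sign choices together satisfy
--     (|a + b|² + M)⁴ + (|a - b|² + M)⁴ ≤ 2 (a² + 7b² + M)⁴,
-- so one of them does not increase the potential (with the slack reduced by 7b²).
-- At the end every vertex has D_v⁸ ≤ Φ_0 ≤ 2n (7r²n)⁴, which forces D_v³ < n² once
-- n > 8 (7r²)¹².

module Submission where

open import Defs
open import Data.Nat using (ℕ; _≤_; _<_; _*_; _^_; ∣_-_∣)
open import Data.Fin.Subset using (Subset; ∣_∣; ∁)
open import Data.Fin using (Fin)
open import Data.Product using (Σ; ∃; _×_)
open import Relation.Binary.PropositionalEquality using (_≡_)

open import Data.Nat using (zero; suc; _+_; _∸_; _<?_)
open import Data.Nat.Properties
open import Data.Nat.Tactic.RingSolver using (solve-∀)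
-- the reflective solver does not handle _^_, so identities with powers use this one
open import Data.Nat.Solver using (module +-*-Solver)
open +-*-Solver using (solve; _:+_; _:*_; _:^_; con; _:=_)
open import Data.Bool using (Bool; true; false; not; if_then_else_)
open import Data.Fin using (zero; suc; _↑ˡ_; _↑ʳ_)
open import Data.Fin.Subset.Properties using (∣p∣≤n; ∣∁p∣≡n∸∣p∣)
open import Data.Vec using (_++_; []; _∷_; lookup; tabulate)
open import Data.Vec.Properties using (lookup-++ˡ; lookup-++ʳ; lookup-map; lookup∘tabulate)
import Data.Vec.Functional as Vector
import Data.List as List
import Data.List.Properties as ListProperties
import Data.Nat.ListAction as ListAction
open import Data.Product using (_,_; proj₁; proj₂)
open import Data.Sum using (inj₁; inj₂)
open import Function using (_∘_; id)
open import Relation.Binary.PropositionalEquality using (refl; sym; trans; cong; cong₂; subst; subst₂; module ≡-Reasoning)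
open import Relation.Binary.Consequences using (wlog)
open import Relation.Nullary using (yes; no)
open import Data.Empty using (⊥-elim)
open import Algebra.Properties.Semiring.Sum +-*-semiring
  using (sum-syntax; sum-cong-≗; ∑-distrib-+; *-distribˡ-sum)

∑-mono : ∀ {N} {f g : Fin N → ℕ} → (∀ i → f i ≤ g i) → ∑[ i < N ] f i ≤ ∑[ i < N ] g i
∑-mono {zero}  f≤g = ≤-refl
∑-mono {suc N} f≤g = +-mono-≤ (f≤g zero) (∑-mono (f≤g ∘ suc))

∑-term : ∀ {N} (f : Fin N → ℕ) i → f i ≤ ∑[ j < N ] f j
∑-term f zero    = m≤m+n _ _
∑-term f (suc i) = ≤-trans (∑-term (f ∘ suc) i) (m≤n+m _ _)

∑-const : ∀ N c → ∑[ i < N ] c ≡ N * c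
∑-const zero    c = refl
∑-const (suc N) c = cong (c +_) (∑-const N c)

∑-split : ∀ m {n} (g : Fin (m + n) → ℕ) →
  ∑[ i < m + n ] g i ≡ ∑[ i < m ] g (i ↑ˡ n) + ∑[ j < n ] g (m ↑ʳ j)
∑-split zero    g = refl
∑-split (suc m) g = trans (cong (g zero +_) (∑-split m (g ∘ suc))) (sym (+-assoc (g zero) _ _))

-- The one-step inequality for the weights (D² + M)⁴

-- contribution of a vertex with discrepancy d to the potential with slack M
weight : ℕ → ℕ → ℕ
weight M d = (d * d + M) ^ 4

-- |a - b|² = a² + b² - 2ab, stated without subtraction
distance-square : ∀ a b → ∣ a - b ∣ * ∣ a - b ∣ + 2 * (a * b) ≡ a * a + b * b
distance-square = wlog {Q = Q} ≤-total (λ {a} {b} → flipped {a} {b}) ordered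
  where
  Q : ℕ → ℕ → Set
  Q a b = ∣ a - b ∣ * ∣ a - b ∣ + 2 * (a * b) ≡ a * a + b * b
  flipped : ∀ {a b} → Q a b → Q b a
  flipped {a} {b} h = begin
    ∣ b - a ∣ * ∣ b - a ∣ + 2 * (b * a) ≡⟨ cong₂ (λ d m → d * d + 2 * m) (∣-∣-comm b a) (*-comm b a) ⟩
    ∣ a - b ∣ * ∣ a - b ∣ + 2 * (a * b) ≡⟨ h ⟩
    a * a + b * b                       ≡⟨ +-comm (a * a) (b * b) ⟩
    b * b + a * a                       ∎
    where open ≡-Reasoning
  ordered : ∀ a b → a ≤ b → Q a b
  ordered a b a≤b = subst (Q a) (m+[n∸m]≡n a≤b) (shifted (b ∸ a))
    where
    expand : ∀ a d → d * d + 2 * (a * (a + d)) ≡ a * a + (a + d) * (a + d)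
    expand = solve-∀
    shifted : ∀ d → Q a (a + d)
    shifted d rewrite ∣m-m+n∣≡n a d = expand a d

-- (X + Q)⁴ + (X - Q)⁴ = 2 (X⁴ + 6X²Q² + Q⁴), written with P = X - Q
binomial-fourth : ∀ P Q →
  (P + 2 * Q) ^ 4 + P ^ 4 ≡ 2 * ((P + Q) ^ 4 + 6 * (P + Q) ^ 2 * (Q * Q) + (Q * Q) ^ 2)
binomial-fourth = solve 2 (λ P Q →
  (P :+ con 2 :* Q) :^ 4 :+ P :^ 4
    := con 2 :* ((P :+ Q) :^ 4 :+ con 6 :* (P :+ Q) :^ 2 :* (Q :* Q) :+ (Q :* Q) :^ 2)) refl

fourth-power-slack : ∀ X K B → K ≤ 4 * X * B →
  X ^ 4 + 6 * X ^ 2 * K + K ^ 2 ≤ (X + 6 * B) ^ 4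
fourth-power-slack X K B K≤ = begin
  X ^ 4 + 6 * X ^ 2 * K + K ^ 2
    ≤⟨ +-mono-≤ (+-monoʳ-≤ (X ^ 4) (*-monoʳ-≤ (6 * X ^ 2) K≤)) (^-monoˡ-≤ 2 K≤) ⟩
  X ^ 4 + 6 * X ^ 2 * (4 * X * B) + (4 * X * B) ^ 2
    ≤⟨ m≤m+n _ (200 * X ^ 2 * B ^ 2 + 864 * X * B ^ 3 + 1296 * B ^ 4) ⟩
  X ^ 4 + 6 * X ^ 2 * (4 * X * B) + (4 * X * B) ^ 2
    + (200 * X ^ 2 * B ^ 2 + 864 * X * B ^ 3 + 1296 * B ^ 4)
    ≡⟨ expand X B ⟩
  (X + 6 * B) ^ 4 ∎
  where
  open ≤-Reasoning
  expand : ∀ X B → X ^ 4 + 6 * X ^ 2 * (4 * X * B) + (4 * X * B) ^ 2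
    + (200 * X ^ 2 * B ^ 2 + 864 * X * B ^ 3 + 1296 * B ^ 4) ≡ (X + 6 * B) ^ 4
  expand = solve 2 (λ X B →
    X :^ 4 :+ con 6 :* X :^ 2 :* (con 4 :* X :* B) :+ (con 4 :* X :* B) :^ 2
      :+ (con 200 :* X :^ 2 :* B :^ 2 :+ con 864 :* X :* B :^ 3 :+ con 1296 :* B :^ 4)
      := (X :+ con 6 :* B) :^ 4) refl

spread-bound : ∀ M a b →
  weight M (a + b) + weight M ∣ a - b ∣ ≤ 2 * weight (7 * (b * b) + M) a
spread-bound M a b = begin
  ((a + b) * (a + b) + M) ^ 4 + P ^ 4                         ≡⟨ cong (λ t → t ^ 4 + P ^ 4) outer ⟩
  (P + 2 * Q) ^ 4 + P ^ 4                                     ≡⟨ binomial-fourth P Q ⟩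
  2 * ((P + Q) ^ 4 + 6 * (P + Q) ^ 2 * (Q * Q) + (Q * Q) ^ 2) ≡⟨ cong (λ Y → 2 * (Y ^ 4 + 6 * Y ^ 2 * (Q * Q) + (Q * Q) ^ 2)) centre ⟩
  2 * (X ^ 4 + 6 * X ^ 2 * (Q * Q) + (Q * Q) ^ 2)             ≤⟨ *-monoʳ-≤ 2 (fourth-power-slack X (Q * Q) (b * b) cross) ⟩
  2 * (X + 6 * (b * b)) ^ 4                                   ≡⟨ cong (λ t → 2 * t ^ 4) (regroup (a * a) (b * b) M) ⟩
  2 * weight (7 * (b * b) + M) a                              ∎
  where
  open ≤-Reasoning
  swap-last : ∀ x M q → x + M + q ≡ x + q + M
  swap-last = solve-∀
  expand-square : ∀ a b M → (a + b) * (a + b) + M ≡ a * a + b * b + 2 * (a * b) + M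
  expand-square = solve-∀
  collect : ∀ x q M → x + q + q + M ≡ x + M + 2 * q
  collect = solve-∀
  square-product : ∀ a b → 2 * (a * b) * (2 * (a * b)) ≡ 4 * (a * a) * (b * b)
  square-product = solve-∀
  regroup : ∀ A B M → A + B + M + 6 * B ≡ A + (7 * B + M)
  regroup = solve-∀
  s P Q X : ℕ
  s = ∣ a - b ∣
  P = s * s + M
  Q = 2 * (a * b)
  X = a * a + b * b + M
  centre : P + Q ≡ X
  centre = trans (swap-last (s * s) M Q) (cong (_+ M) (distance-square a b))
  outer : (a + b) * (a + b) + M ≡ P + 2 * Q
  outer = begin-equality
    (a + b) * (a + b) + M   ≡⟨ expand-square a b M ⟩
    a * a + b * b + Q + M   ≡⟨ cong (λ t → t + Q + M) (distance-square a b) ⟨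
    s * s + Q + Q + M       ≡⟨ collect (s * s) Q M ⟩
    P + 2 * Q               ∎
  -- Q² = 4a²b² ≤ 4Xb² because a² ≤ X
  cross : Q * Q ≤ 4 * X * (b * b)
  cross = begin
    Q * Q                   ≡⟨ square-product a b ⟩
    4 * (a * a) * (b * b)   ≤⟨ *-monoˡ-≤ (b * b) (*-monoʳ-≤ 4 (≤-trans (m≤m+n (a * a) (b * b)) (m≤m+n _ M))) ⟩
    4 * X * (b * b)         ∎

-- cost of the two ways of adding α and β to the two sides x and y of a vertex
spread : ℕ → ℕ → ℕ → ℕ → ℕ → ℕ
spread M x y α β = weight M ∣ (x + α) - (y + β) ∣ + weight M ∣ (x + β) - (y + α) ∣

-- the two new discrepancies are |x - y| + |α - β| and ||x - y| - |α - β||, so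
-- spread-bound applies; both spread and the bound are symmetric in x,y and in α,β
exchange-bound : ∀ M x y α β →
  spread M x y α β ≤ 2 * weight (7 * (∣ α - β ∣ * ∣ α - β ∣) + M) ∣ x - y ∣
exchange-bound M x y α β = wlog {Q = Q} ≤-total (λ {y} {x} → swap-sides {y} {x}) ordered y x α β
  where
  bound : ℕ → ℕ → ℕ → ℕ → ℕ
  bound x y α β = 2 * weight (7 * (∣ α - β ∣ * ∣ α - β ∣) + M) ∣ x - y ∣
  Q : ℕ → ℕ → Set
  Q y x = ∀ α β → spread M x y α β ≤ bound x y α β
  swap-sides : ∀ {y x} → Q y x → Q x y
  swap-sides {y} {x} h α β = subst₂ _≤_
    (trans (cong₂ (λ d e → weight M d + weight M e) (∣-∣-comm (x + α) (y + β)) (∣-∣-comm (x + β) (y + α)))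
           (+-comm (weight M ∣ (y + β) - (x + α) ∣) (weight M ∣ (y + α) - (x + β) ∣)))
    (cong (λ d → 2 * weight (7 * (∣ α - β ∣ * ∣ α - β ∣) + M) d) (∣-∣-comm x y))
    (h α β)
  swap-amounts : ∀ {x y β α} → spread M x y α β ≤ bound x y α β → spread M x y β α ≤ bound x y β α
  swap-amounts {x} {y} {β} {α} h = subst₂ _≤_
    (+-comm (weight M ∣ (x + α) - (y + β) ∣) (weight M ∣ (x + β) - (y + α) ∣))
    (cong (λ e → 2 * weight (7 * (e * e) + M) ∣ x - y ∣) (∣-∣-comm α β)) h
  cancel : ∀ k u w {X Y} → X ≡ k + u → Y ≡ k + w → ∣ X - Y ∣ ≡ ∣ u - w ∣
  cancel k u w refl refl = ∣m+n-m+o∣≡∣n-o∣ k u w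
  shift : ∀ y a → ∣ (y + a) - y ∣ ≡ a
  shift y a = trans (∣-∣-comm (y + a) y) (∣m-m+n∣≡n y a)
  rearrange₁ : ∀ y a β b → y + a + (β + b) ≡ y + β + (a + b)
  rearrange₁ = solve-∀
  rearrange₂ : ∀ y a β → y + a + β ≡ y + β + a
  rearrange₂ = solve-∀
  base : ∀ y a β b → spread M (y + a) y (β + b) β ≤ bound (y + a) y (β + b) β
  base y a β b = begin
    spread M (y + a) y (β + b) β
      ≡⟨ cong₂ (λ d e → weight M d + weight M e)
           (trans (cancel (y + β) (a + b) 0 (rearrange₁ y a β b) (sym (+-identityʳ (y + β)))) (∣-∣-identityʳ (a + b)))
           (cancel (y + β) a b (rearrange₂ y a β) (sym (+-assoc y β b))) ⟩
    weight M (a + b) + weight M ∣ a - b ∣  ≤⟨ spread-bound M a b ⟩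
    2 * weight (7 * (b * b) + M) a         ≡⟨ cong₂ (λ d e → 2 * weight (7 * (e * e) + M) d) (shift y a) (shift β b) ⟨
    bound (y + a) y (β + b) β              ∎
    where open ≤-Reasoning
  ordered : ∀ y x → y ≤ x → Q y x
  ordered y x y≤x = subst (Q y) (m+[n∸m]≡n y≤x) (shifted (x ∸ y))
    where
    shifted : ∀ a → Q y (y + a)
    shifted a α β = wlog {Q = λ β α → spread M (y + a) y α β ≤ bound (y + a) y α β} ≤-total
      (λ {β} {α} → swap-amounts {y + a} {y} {β} {α})
      (λ β α β≤α → subst (λ α → spread M (y + a) y α β ≤ bound (y + a) y α β) (m+[n∸m]≡n β≤α) (base y a β (α ∸ β)))
      β α

-- Greedy balancing of ±-rounds

weight-mono : ∀ {M M′} d → M ≤ M′ → weight M d ≤ weight M′ d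
weight-mono d M≤M′ = ^-monoˡ-≤ 4 (+-monoʳ-≤ (d * d) M≤M′)

potential : ∀ {N} → ℕ → (Fin N → ℕ) → (Fin N → ℕ) → ℕ
potential {N} M p q = ∑[ v < N ] weight M ∣ p v - q v ∣

potential-step : ∀ {μ r} → 7 * (r * r) ≤ μ → ∀ {N} M (p q α β : Fin N → ℕ) →
  (∀ v → ∣ α v - β v ∣ ≤ r) →
  potential M (λ v → p v + α v) (λ v → q v + β v) + potential M (λ v → p v + β v) (λ v → q v + α v)
    ≤ 2 * potential (μ + M) p q
potential-step {μ} {r} μ≥ {N} M p q α β α≈β = begin
  potential M (λ v → p v + α v) (λ v → q v + β v) + potential M (λ v → p v + β v) (λ v → q v + α v)
    ≡⟨ ∑-distrib-+ (λ v → weight M ∣ (p v + α v) - (q v + β v) ∣) (λ v → weight M ∣ (p v + β v) - (q v + α v) ∣) ⟨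
  ∑[ v < N ] spread M (p v) (q v) (α v) (β v)   ≤⟨ ∑-mono at-vertex ⟩
  ∑[ v < N ] (2 * weight (μ + M) ∣ p v - q v ∣) ≡⟨ *-distribˡ-sum 2 (λ v → weight (μ + M) ∣ p v - q v ∣) ⟨
  2 * potential (μ + M) p q                      ∎
  where
  open ≤-Reasoning
  at-vertex : ∀ v → spread M (p v) (q v) (α v) (β v) ≤ 2 * weight (μ + M) ∣ p v - q v ∣
  at-vertex v = ≤-trans (exchange-bound M (p v) (q v) (α v) (β v))
    (*-monoʳ-≤ 2 (weight-mono ∣ p v - q v ∣
      (+-monoˡ-≤ M (≤-trans (*-monoʳ-≤ 7 (*-mono-≤ (α≈β v) (α≈β v))) μ≥))))

one-below-average : ∀ (f : Bool → ℕ) T → f true + f false ≤ 2 * T → ∃ λ c → f c ≤ T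
one-below-average f T sum≤ with f true ≤? T
... | yes t≤ = true , t≤
... | no t≰ = false , <⇒≤ (+-cancelˡ-< T (f false) T (begin-strict
  T + f false       <⟨ +-monoˡ-< (f false) (≰⇒> t≰) ⟩
  f true + f false  ≤⟨ sum≤ ⟩
  2 * T             ≡⟨ cong (T +_) (+-identityʳ T) ⟩
  T + T             ∎))
  where open ≤-Reasoning

side : ∀ {k N} → (Fin k → Bool) → (α β : Fin k → Fin N → ℕ) → Fin N → ℕ
side {k} b α β v = ∑[ i < k ] (if b i then α i v else β i v)

balance : ∀ {μ r} → 7 * (r * r) ≤ μ → ∀ {N} k (α β : Fin k → Fin N → ℕ) →
  (∀ i v → ∣ α i v - β i v ∣ ≤ r) → (p q : Fin N → ℕ) →
  ∃ λ (b : Fin k → Bool) →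
    potential 0 (λ v → p v + side b α β v) (λ v → q v + side (not ∘ b) α β v) ≤ potential (k * μ) p q
balance μ≥ zero α β α≈β p q = (λ ()) , ≤-reflexive (sum-cong-≗ λ v →
  cong₂ (λ x y → weight 0 ∣ x - y ∣) (+-identityʳ (p v)) (+-identityʳ (q v)))
balance {μ} μ≥ {N} (suc k) α β α≈β p q = c Vector.∷ b , ≤-trans (≤-reflexive regroup) (≤-trans (proj₂ rest) (proj₂ round₀))
  where
  p′ q′ : Bool → Fin N → ℕ
  p′ c v = p v + (if c then α zero v else β zero v)
  q′ c v = q v + (if not c then α zero v else β zero v)
  round₀ : ∃ λ c → potential (k * μ) (p′ c) (q′ c) ≤ potential (suc k * μ) p q
  round₀ = one-below-average (λ c → potential (k * μ) (p′ c) (q′ c)) (potential (suc k * μ) p q)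
             (potential-step μ≥ (k * μ) p q (α zero) (β zero) (α≈β zero))
  c : Bool
  c = proj₁ round₀
  rest : ∃ λ b → potential 0 (λ v → p′ c v + side b (α ∘ suc) (β ∘ suc) v)
                             (λ v → q′ c v + side (not ∘ b) (α ∘ suc) (β ∘ suc) v)
                 ≤ potential (k * μ) (p′ c) (q′ c)
  rest = balance μ≥ k (α ∘ suc) (β ∘ suc) (α≈β ∘ suc) (p′ c) (q′ c)
  b : Fin k → Bool
  b = proj₁ rest
  regroup : potential 0 (λ v → p v + side (c Vector.∷ b) α β v) (λ v → q v + side (not ∘ (c Vector.∷ b)) α β v)
          ≡ potential 0 (λ v → p′ c v + side b (α ∘ suc) (β ∘ suc) v)
                        (λ v → q′ c v + side (not ∘ b) (α ∘ suc) (β ∘ suc) v)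
  regroup = sum-cong-≗ λ v →
    cong₂ (λ x y → weight 0 ∣ x - y ∣) (sym (+-assoc (p v) _ _)) (sym (+-assoc (q v) _ _))

-- D⁸ ≤ 2n (nμ)⁴ gives D²⁴ ≤ 8μ¹² n¹⁵ < n¹⁶, i.e. D³ < n², once n > 8μ¹²
small-discrepancy : ∀ μ n D → 8 * μ ^ 12 < n → weight 0 D ≤ 2 * n * (n * μ) ^ 4 → D ^ 3 < n ^ 2
small-discrepancy μ n@(suc _) D n> D≤ with D ^ 3 <? n ^ 2
... | yes D³< = D³<
... | no D³≮ = ⊥-elim (<⇒≱ n> (*-cancelʳ-≤ n (8 * μ ^ 12) (n ^ 15) {{m^n≢0 n 15}} (begin
  n * n ^ 15                 ≡⟨ sixteenth n ⟩
  (n ^ 2) ^ 8                ≤⟨ ^-monoˡ-≤ 8 (≮⇒≥ D³≮) ⟩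
  (D ^ 3) ^ 8                ≡⟨ twenty-fourth D ⟩
  weight 0 D ^ 3             ≤⟨ ^-monoˡ-≤ 3 D≤ ⟩
  (2 * n * (n * μ) ^ 4) ^ 3  ≡⟨ bound-cubed n μ ⟩
  8 * μ ^ 12 * n ^ 15        ∎)))
  where
  open ≤-Reasoning
  sixteenth : ∀ n → n * n ^ 15 ≡ (n ^ 2) ^ 8
  sixteenth = solve 1 (λ n → n :* n :^ 15 := (n :^ 2) :^ 8) refl
  twenty-fourth : ∀ D → (D ^ 3) ^ 8 ≡ ((D * D + 0) ^ 4) ^ 3
  twenty-fourth = solve 1 (λ D → (D :^ 3) :^ 8 := ((D :* D :+ con 0) :^ 4) :^ 3) refl
  bound-cubed : ∀ n μ → (2 * n * (n * μ) ^ 4) ^ 3 ≡ 8 * μ ^ 12 * n ^ 15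
  bound-cubed = solve 2 (λ n μ → (con 2 :* n :* (n :* μ) :^ 4) :^ 3 := con 8 :* μ :^ 12 :* n :^ 15) refl

-- Bisections of a graph on 2n vertices obtained from a pairing

sum-tabulate : ∀ {k} (g : Fin k → ℕ) → ListAction.sum (List.tabulate g) ≡ ∑[ i < k ] g i
sum-tabulate {zero}  g = refl
sum-tabulate {suc k} g = cong (g zero +_) (sum-tabulate (g ∘ suc))

deg≡∑ : ∀ {k} (G : Multigraph k) S v → deg G S v ≡ ∑[ u < k ] (if lookup S u then mult G v u else 0)
deg≡∑ {k} G S v = trans (cong ListAction.sum (ListProperties.map-tabulate id term)) (sum-tabulate term)
  where
  term : Fin k → ℕ
  term u = if lookup S u then mult G v u else 0

first second : ∀ {n} → Fin n → Fin (2 * n)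
first  {n} i = i ↑ˡ (n + 0)
second {n} i = n ↑ʳ (i ↑ˡ 0)

∑-pairs : ∀ n (g : Fin (2 * n) → ℕ) → ∑[ x < 2 * n ] g x ≡ ∑[ i < n ] (g (first i) + g (second i))
∑-pairs n g = begin
  ∑[ x < 2 * n ] g x                                        ≡⟨ ∑-split n g ⟩
  ∑[ i < n ] g (first i) + ∑[ j < n + 0 ] g (n ↑ʳ j)        ≡⟨ cong (∑[ i < n ] g (first i) +_) second-half ⟩
  ∑[ i < n ] g (first i) + ∑[ i < n ] g (second i)          ≡⟨ ∑-distrib-+ {n} (λ i → g (first i)) (λ i → g (second i)) ⟨
  ∑[ i < n ] (g (first i) + g (second i))                   ∎
  where
  open ≡-Reasoning
  second-half : ∑[ j < n + 0 ] g (n ↑ʳ j) ≡ ∑[ i < n ] g (second i)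
  second-half = trans (∑-split n (g ∘ (n ↑ʳ_))) (+-identityʳ _)

select-complement : ∀ c {x y : ℕ} → (if c then x else 0) + (if not c then y else 0) ≡ (if c then x else y)
select-complement true  = +-identityʳ _
select-complement false = refl

deg-paired : ∀ {n} (G : Multigraph (2 * n)) (X : Subset (2 * n)) (b : Fin n → Bool) →
  (∀ i → lookup X (first i) ≡ b i) → (∀ i → lookup X (second i) ≡ not (b i)) →
  ∀ v → deg G X v ≡ ∑[ i < n ] (if b i then mult G v (first i) else mult G v (second i))
deg-paired {n} G X b X-first X-second v = begin
  deg G X v                                                         ≡⟨ deg≡∑ G X v ⟩
  ∑[ x < 2 * n ] term x                                             ≡⟨ ∑-pairs n term ⟩
  ∑[ i < n ] (term (first i) + term (second i))                     ≡⟨ sum-cong-≗ select-pair ⟩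
  ∑[ i < n ] (if b i then mult G v (first i) else mult G v (second i)) ∎
  where
  open ≡-Reasoning
  term : Fin (2 * n) → ℕ
  term x = if lookup X x then mult G v x else 0
  select-pair : ∀ i → term (first i) + term (second i) ≡ (if b i then mult G v (first i) else mult G v (second i))
  select-pair i rewrite X-first i | X-second i = select-complement (b i)

paired : ∀ {n} → (Fin n → Bool) → Subset (2 * n)
paired b = tabulate b ++ (∁ (tabulate b) ++ [])

paired-first : ∀ {n} (b : Fin n → Bool) i → lookup (paired b) (first i) ≡ b i
paired-first b i = trans (lookup-++ˡ (tabulate b) _ i) (lookup∘tabulate b i)

paired-second : ∀ {n} (b : Fin n → Bool) i → lookup (paired b) (second i) ≡ not (b i)
paired-second b i = begin
  lookup (paired b) (second i)        ≡⟨ lookup-++ʳ (tabulate b) _ (i ↑ˡ 0) ⟩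
  lookup (∁ (tabulate b) ++ []) (i ↑ˡ 0) ≡⟨ lookup-++ˡ (∁ (tabulate b)) [] i ⟩
  lookup (∁ (tabulate b)) i           ≡⟨ lookup-map i not (tabulate b) ⟩
  not (lookup (tabulate b) i)         ≡⟨ cong not (lookup∘tabulate b i) ⟩
  not (b i)                           ∎
  where open ≡-Reasoning

∣++∣ : ∀ {m n} (xs : Subset m) (ys : Subset n) → ∣ xs ++ ys ∣ ≡ ∣ xs ∣ + ∣ ys ∣
∣++∣ []           ys = refl
∣++∣ (true  ∷ xs) ys = cong suc (∣++∣ xs ys)
∣++∣ (false ∷ xs) ys = ∣++∣ xs ys

∣paired∣ : ∀ {n} (b : Fin n → Bool) → ∣ paired b ∣ ≡ n
∣paired∣ {n} b = begin
  ∣ xs ++ (∁ xs ++ []) ∣    ≡⟨ trans (∣++∣ xs _) (cong (∣ xs ∣ +_) (trans (∣++∣ (∁ xs) []) (+-identityʳ _))) ⟩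
  ∣ xs ∣ + ∣ ∁ xs ∣         ≡⟨ cong (∣ xs ∣ +_) (∣∁p∣≡n∸∣p∣ xs) ⟩
  ∣ xs ∣ + (n ∸ ∣ xs ∣)     ≡⟨ m+[n∸m]≡n (∣p∣≤n xs) ⟩
  n                         ∎
  where
  open ≡-Reasoning
  xs = tabulate b

∣∁paired∣ : ∀ {n} (b : Fin n → Bool) → ∣ ∁ (paired b) ∣ ≡ n
∣∁paired∣ {n} b = begin
  ∣ ∁ (paired b) ∣          ≡⟨ ∣∁p∣≡n∸∣p∣ (paired b) ⟩
  n + (n + 0) ∸ ∣ paired b ∣ ≡⟨ cong (n + (n + 0) ∸_) (∣paired∣ b) ⟩
  n + (n + 0) ∸ n           ≡⟨ trans (m+n∸m≡n n (n + 0)) (+-identityʳ n) ⟩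
  n                         ∎
  where open ≡-Reasoning

∣-∣-bounded : ∀ {m n r} → m ≤ r → n ≤ r → ∣ m - n ∣ ≤ r
∣-∣-bounded {m} {n} m≤r n≤r with ∣m-n∣≡[m∸n]∨[n∸m] m n
... | inj₁ ∣m-n∣≡m∸n = subst (_≤ _) (sym ∣m-n∣≡m∸n) (≤-trans (m∸n≤m m n) m≤r)
... | inj₂ ∣m-n∣≡n∸m = subst (_≤ _) (sym ∣m-n∣≡n∸m) (≤-trans (m∸n≤m n m) n≤r)

-- Pair vertex i with n + i, let round i of the balancing lemma add the
-- multiplicities to the two members of pair i, and start with empty sides: some
-- bisection has D_v⁸ ≤ 2n (7r²n)⁴ at every vertex v.
balanced-bisection : ∀ {r} n (G : Multigraph (2 * n)) → MultiplicityAtMost r G →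
  ∃ λ (b : Fin n → Bool) → ∀ v →
    weight 0 ∣ deg G (paired b) v - deg G (∁ (paired b)) v ∣ ≤ 2 * n * (n * (7 * (r * r))) ^ 4
balanced-bisection {r} n G mult≤r = b , λ v → begin
  weight 0 ∣ deg G (paired b) v - deg G (∁ (paired b)) v ∣
    ≡⟨ cong₂ (λ x y → weight 0 ∣ x - y ∣) (deg-A v) (deg-∁A v) ⟩
  weight 0 ∣ side b α β v - side (not ∘ b) α β v ∣
    ≤⟨ ∑-term (λ u → weight 0 ∣ side b α β u - side (not ∘ b) α β u ∣) v ⟩
  potential 0 (side b α β) (side (not ∘ b) α β)          ≤⟨ proj₂ chosen ⟩
  potential {2 * n} (n * μ) (λ _ → 0) (λ _ → 0)          ≡⟨ ∑-const (2 * n) ((n * μ) ^ 4) ⟩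
  2 * n * (n * μ) ^ 4                                    ∎
  where
  open ≤-Reasoning
  μ : ℕ
  μ = 7 * (r * r)
  α β : Fin n → Fin (2 * n) → ℕ
  α i v = mult G v (first i)
  β i v = mult G v (second i)
  chosen : ∃ λ b → potential 0 (side b α β) (side (not ∘ b) α β) ≤ potential {2 * n} (n * μ) (λ _ → 0) (λ _ → 0)
  chosen = balance ≤-refl n α β (λ i v → ∣-∣-bounded (mult≤r v (first i)) (mult≤r v (second i))) (λ _ → 0) (λ _ → 0)
  b : Fin n → Bool
  b = proj₁ chosen
  deg-A : ∀ v → deg G (paired b) v ≡ side b α β v
  deg-A = deg-paired G (paired b) b (paired-first b) (paired-second b)
  deg-∁A : ∀ v → deg G (∁ (paired b)) v ≡ side (not ∘ b) α β v
  deg-∁A = deg-paired G (∁ (paired b)) (not ∘ b)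
    (λ i → trans (lookup-map (first i) not (paired b)) (cong not (paired-first b i)))
    (λ i → trans (lookup-map (second i) not (paired b)) (cong not (paired-second b i)))

-- N* = 8 (7r²)¹² + 1 works, by small-discrepancy applied to the bisection above
lemma13 : (r : ℕ) → 1 ≤ r →
    ∃ λ (N* : ℕ) → (n : ℕ) → N* ≤ n →
    (G : Multigraph (2 * n)) → MultiplicityAtMost r G →
    Σ (Subset (2 * n)) λ A →
    (∣ A ∣ ≡ n) × (∣ ∁ A ∣ ≡ n) ×
    ((v : Fin (2 * n)) → ∣ deg G A v - deg G (∁ A) v ∣ ^ 3 < n ^ 2)
lemma13 r _ = suc (8 * μ ^ 12) , λ n n> G mult≤r →
  let (b , bounded) = balanced-bisection n G mult≤r
  in  paired b , ∣paired∣ b , ∣∁paired∣ b ,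
      λ v → small-discrepancy μ n ∣ deg G (paired b) v - deg G (∁ (paired b)) v ∣ n> (bounded v)
  where
  μ : ℕ
  μ = 7 * (r * r)
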